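{- If $(m,n)$ is an admissible pair of positive integers, then \[ E(m+10,n+10) = 164\,E(m+5,n+5) - 27\,E(m,n). \]
   Context: Let $\mathcal P_\infty$ be the poset whose elements are two infinite chains $a_1<a_2<a_3<\cdots$ and $b_1<b_2<b_3<\cdots$, whose order is generated (by transitivity) by these chain relations together with the additional covering relations: $a_i \le b_{i+1}$ whenever $i \equiv 1,2,3,4 \pmod 5$, and $b_j \le a_{j+2}$ whenever $j \equiv 0,2,4 \pmod 5$. For positive integers $m,n$, $\mathcal P(m,n)$ is the subposet of $\mathcal P_\infty$ induced on $\{a_1,\dots,a_m,b_1,\dots,b_n\}$ (with the order inherited from $\mathcal P_\infty$), and $E(m,n)$ is the number of linear extensions of $\mathcal P(m,n)$. A pair $(m,n)$ of positive integers is admissible if $\mathcal P(m,n)$ has no maximum element. -}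

module Defs where

open import Data.Nat using (ℕ; zero; suc; _≤_; _%_)
open import Data.Nat.Properties using (_≟_)
open import Data.Empty using (⊥)
open import Data.Sum using (_⊎_; inj₁; inj₂)
open import Data.Product using (Σ; _×_; _,_)
open import Data.List using (List; []; _∷_; _++_; map; upTo; concatMap; length; filter)
open import Data.List.Relation.Unary.AllPairs using (AllPairs; allPairs?)
open import Relation.Nullary using (¬_; Dec; yes; no)
open import Relation.Nullary.Decidable using (_⊎-dec_; _×-dec_; ¬?)
open import Relation.Binary.PropositionalEquality using (_≡_; refl; _≢_)
open import Relation.Binary.Construct.Closure.ReflexiveTransitive using (Star; ε; _◅_)

-- Only indices i, j ≥ 1 are elements of P∞;
-- the generating relations below only involve indices ≥ 1, and every
-- generating step strictly increases the index, so the values a 0, b 0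
-- are isolated and never occur inside P(m,n).

data Elem : Set where
  a : ℕ → Elem
  b : ℕ → Elem

CondA : ℕ → Set
CondA i = ¬ (i % 5 ≡ 0)

CondB : ℕ → Set
CondB j = (j % 5 ≡ 0) ⊎ ((j % 5 ≡ 2) ⊎ (j % 5 ≡ 4))

data Gen : Elem → Elem → Set where
  a↑ : ∀ i → Gen (a (suc i)) (a (suc (suc i)))
  b↑ : ∀ j → Gen (b (suc j)) (b (suc (suc j)))
  ab : ∀ i → CondA (suc i) → Gen (a (suc i)) (b (suc (suc i)))
  ba : ∀ j → CondB (suc j) → Gen (b (suc j)) (a (suc (suc (suc j))))

infix 4 _≼_
_≼_ : Elem → Elem → Set
_≼_ = Star Gen

private
  a-inj : ∀ {i j} → a i ≡ a j → i ≡ j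
  a-inj refl = refl
  b-inj : ∀ {i j} → b i ≡ b j → i ≡ j
  b-inj refl = refl

_≟E_ : (x y : Elem) → Dec (x ≡ y)
a i ≟E a j with i ≟ j
... | yes refl = yes refl
... | no ne = no (λ e → ne (a-inj e))
a i ≟E b j = no (λ ())
b i ≟E a j = no (λ ())
b i ≟E b j with i ≟ j
... | yes refl = yes refl
... | no ne = no (λ e → ne (b-inj e))

private
  snoc-view : ∀ {x y} → x ≼ y → (x ≡ y) ⊎ Σ Elem (λ z → (x ≼ z) × Gen z y)
  snoc-view ε = inj₁ refl
  snoc-view (g ◅ p) with snoc-view p
  ... | inj₁ refl = inj₂ (_ , ε , g)
  ... | inj₂ (z , q , h) = inj₂ (z , g ◅ q , h)

  snoc : ∀ {x y z} → x ≼ y → Gen y z → x ≼ z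
  snoc ε g = g ◅ ε
  snoc (h ◅ p) g = h ◅ snoc p g

  condA? : ∀ i → Dec (CondA i)
  condA? i = ¬? ((i % 5) ≟ 0)

  condB? : ∀ j → Dec (CondB j)
  condB? j = ((j % 5) ≟ 0) ⊎-dec (((j % 5) ≟ 2) ⊎-dec ((j % 5) ≟ 4))

  no-pred : ∀ {x y} → (∀ {z} → ¬ Gen z y) → Dec (x ≡ y) → Dec (x ≼ y)
  no-pred np (yes refl) = yes ε
  no-pred np (no ne) = no λ p → help (snoc-view p)
    where
    help : _ → ⊥
    help (inj₁ e) = ne e
    help (inj₂ (_ , _ , g)) = np g

  decA : ∀ x k → Dec (x ≼ a k)
  decB : ∀ x k → Dec (x ≼ b k)

  decA x 0 = no-pred (λ ()) (x ≟E a 0)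
  decA x 1 = no-pred (λ ()) (x ≟E a 1)
  decA x 2 with x ≟E a 2 | decA x 1
  ... | yes refl | _ = yes ε
  ... | no _ | yes p = yes (snoc p (a↑ 0))
  ... | no ne | no np = no λ q → help (snoc-view q)
    where
    help : _ → ⊥
    help (inj₁ e) = ne e
    help (inj₂ (_ , r , a↑ .0)) = np r
  decA x (suc (suc (suc j))) with x ≟E a (suc (suc (suc j))) | decA x (suc (suc j)) | condB? (suc j) | decB x (suc j)
  ... | yes refl | _ | _ | _ = yes ε
  ... | no _ | yes p | _ | _ = yes (snoc p (a↑ (suc j)))
  ... | no _ | no _ | yes c | yes p = yes (snoc p (ba j c))
  ... | no ne | no np | yes c | no nq = no λ q → help (snoc-view q)
    where
    help : _ → ⊥
    help (inj₁ e) = ne e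
    help (inj₂ (_ , r , a↑ _)) = np r
    help (inj₂ (_ , r , ba _ _)) = nq r
  ... | no ne | no np | no nc | _ = no λ q → help (snoc-view q)
    where
    help : _ → ⊥
    help (inj₁ e) = ne e
    help (inj₂ (_ , r , a↑ _)) = np r
    help (inj₂ (_ , r , ba _ c)) = nc c

  decB x 0 = no-pred (λ ()) (x ≟E b 0)
  decB x 1 = no-pred (λ ()) (x ≟E b 1)
  decB x (suc (suc k)) with x ≟E b (suc (suc k)) | decB x (suc k) | condA? (suc k) | decA x (suc k)
  ... | yes refl | _ | _ | _ = yes ε
  ... | no _ | yes p | _ | _ = yes (snoc p (b↑ k))
  ... | no _ | no _ | yes c | yes p = yes (snoc p (ab k c))
  ... | no ne | no np | yes c | no nq = no λ q → help (snoc-view q)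
    where
    help : _ → ⊥
    help (inj₁ e) = ne e
    help (inj₂ (_ , r , b↑ _)) = np r
    help (inj₂ (_ , r , ab _ _)) = nq r
  ... | no ne | no np | no nc | _ = no λ q → help (snoc-view q)
    where
    help : _ → ⊥
    help (inj₁ e) = ne e
    help (inj₂ (_ , r , b↑ _)) = np r
    help (inj₂ (_ , r , ab _ c)) = nc c

_≼?_ : (x y : Elem) → Dec (x ≼ y)
x ≼? a k = decA x k
x ≼? b k = decB x k

InP : ℕ → ℕ → Elem → Set
InP m n (a i) = (1 ≤ i) × (i ≤ m)
InP m n (b j) = (1 ≤ j) × (j ≤ n)

elems : ℕ → ℕ → List Elem
elems m n = map (λ i → a (suc i)) (upTo m) ++ map (λ j → b (suc j)) (upTo n)

insertions : {A : Set} → A → List A → List (List A)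
insertions x [] = (x ∷ []) ∷ []
insertions x (y ∷ ys) = (x ∷ y ∷ ys) ∷ map (y ∷_) (insertions x ys)

permutations : {A : Set} → List A → List (List A)
permutations [] = [] ∷ []
permutations (x ∷ xs) = concatMap (insertions x) (permutations xs)

Respects : List Elem → Set
Respects = AllPairs (λ x y → ¬ (y ≼ x))

respects? : (L : List Elem) → Dec (Respects L)
respects? = allPairs? (λ x y → ¬? (y ≼? x))

E : ℕ → ℕ → ℕ
E m n = length (filter respects? (permutations (elems m n)))

HasMaximum : ℕ → ℕ → Set
HasMaximum m n = Σ Elem (λ x → InP m n x × (∀ y → InP m n y → y ≼ x))

Admissible : ℕ → ℕ → Set
Admissible m n = ¬ HasMaximum m n

{-# OPTIONS --safe #-}
-- A linear extension of P(m,n) interleaves the chains a₁ < ⋯ < a_m and b₁ < ⋯ < b_n, so it is a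
-- monotone lattice path from (0,0) to (m,n). Peeling off minimal elements shows that the path may
-- place a_{i+1} at (i,j) iff β (i+1) ≤ j, and b_{j+1} iff α (j+1) ≤ i, where β k (α l) is the
-- largest index of a b below a_k (of an a below b_l); admissibility, i.e. a_m and b_n incomparable,
-- guarantees that cutting P∞ down to P(m,n) does not weaken these conditions. P∞ is invariant under
-- shifting all indices by 5, hence so are the step conditions under (i,j) ↦ (i+5,j+5). The path
-- counts at (i,j), (i+5,j+5) and (i+10,j+10) therefore satisfy one and the same last-step
-- recursion, and the relation f(i+10,j+10) + 27 f(i,j) = 164 f(i+5,j+5) propagates from the two
-- boundary lines, where it is checked by computation or reads 0 = 0.
module Submission where

module NaturalToInteger where

  open import Data.Nat using (_+_; _*_)
  open import Relation.Binary.PropositionalEquality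
  open import Data.Integer as ℤ using (ℤ; +_)
  open import Data.Integer.Properties using (pos-+; pos-*)
  open import Data.Integer.Tactic.RingSolver using (solve-∀)

  ℕ-relation⇒ℤ : ∀ x y z k l → x + k * z ≡ l * y → + x ≡ + l ℤ.* + y ℤ.- + k ℤ.* + z
  ℕ-relation⇒ℤ x y z k l relation = begin
    + x                                    ≡⟨ add-sub (+ x) (+ k ℤ.* + z) ⟩
    (+ x ℤ.+ + k ℤ.* + z) ℤ.- + k ℤ.* + z  ≡⟨ cong (λ t → (+ x ℤ.+ t) ℤ.- + k ℤ.* + z) (sym (pos-* k z)) ⟩
    (+ x ℤ.+ + (k * z)) ℤ.- + k ℤ.* + z    ≡⟨ cong (ℤ._- + k ℤ.* + z) (sym (pos-+ x (k * z))) ⟩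
    + (x + k * z) ℤ.- + k ℤ.* + z          ≡⟨ cong (λ t → + t ℤ.- + k ℤ.* + z) relation ⟩
    + (l * y) ℤ.- + k ℤ.* + z              ≡⟨ cong (ℤ._- + k ℤ.* + z) (pos-* l y) ⟩
    + l ℤ.* + y ℤ.- + k ℤ.* + z            ∎
    where
    open ≡-Reasoning
    add-sub : ∀ u v → u ≡ (u ℤ.+ v) ℤ.- v
    add-sub = solve-∀

module LatticePaths where

  open import Data.Nat using (ℕ; zero; suc; _+_; _*_)
  open import Data.Nat.Properties using (+-assoc)
  open import Data.Nat.Tactic.RingSolver using (solve-∀)
  open import Relation.Binary.PropositionalEquality

  Weight : Set
  Weight = ℕ → ℕ → ℕ

  _↑ˣ _↑ʸ : Weight → Weight
  (A ↑ˣ) x y = A (suc x) y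
  (A ↑ʸ) x y = A x (suc y)

  paths : Weight → Weight → ℕ → ℕ → ℕ
  paths A B zero    zero    = 1
  paths A B (suc c) zero    = A c 0 * paths A B c 0
  paths A B zero    (suc d) = B 0 d * paths A B 0 d
  paths A B (suc c) (suc d) = A c (suc d) * paths A B c (suc d) + B (suc c) d * paths A B (suc c) d

  pathsByFirstStep : Weight → Weight → ℕ → ℕ → ℕ
  pathsByFirstStep A B zero    zero    = 1
  pathsByFirstStep A B (suc c) zero    = A 0 0 * pathsByFirstStep (A ↑ˣ) (B ↑ˣ) c 0
  pathsByFirstStep A B zero    (suc d) = B 0 0 * pathsByFirstStep (A ↑ʸ) (B ↑ʸ) 0 d
  pathsByFirstStep A B (suc c) (suc d) =
    A 0 0 * pathsByFirstStep (A ↑ˣ) (B ↑ˣ) c (suc d) + B 0 0 * pathsByFirstStep (A ↑ʸ) (B ↑ʸ) (suc c) d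

  private
    swap-* : ∀ a x p → a * (x * p) ≡ x * (a * p)
    swap-* = solve-∀

    P : Weight → Weight → ℕ → ℕ → ℕ
    P = pathsByFirstStep

  pathsByFirstStep-lastˣ : ∀ A B c → pathsByFirstStep A B (suc c) 0 ≡ A c 0 * pathsByFirstStep A B c 0
  pathsByFirstStep-lastˣ A B zero    = refl
  pathsByFirstStep-lastˣ A B (suc c) =
    trans (cong (A 0 0 *_) (pathsByFirstStep-lastˣ (A ↑ˣ) (B ↑ˣ) c))
          (swap-* (A 0 0) (A (suc c) 0) (P (A ↑ˣ) (B ↑ˣ) c 0))

  pathsByFirstStep-lastʸ : ∀ A B d → pathsByFirstStep A B 0 (suc d) ≡ B 0 d * pathsByFirstStep A B 0 d
  pathsByFirstStep-lastʸ A B zero    = refl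
  pathsByFirstStep-lastʸ A B (suc d) =
    trans (cong (B 0 0 *_) (pathsByFirstStep-lastʸ (A ↑ʸ) (B ↑ʸ) d))
          (swap-* (B 0 0) (B 0 (suc d)) (P (A ↑ʸ) (B ↑ʸ) 0 d))

  pathsByFirstStep-last : ∀ A B c d → pathsByFirstStep A B (suc c) (suc d) ≡
    A c (suc d) * pathsByFirstStep A B c (suc d) + B (suc c) d * pathsByFirstStep A B (suc c) d
  pathsByFirstStep-last A B zero zero = interchange₀₀ (A 0 0) (B 0 0) (A 0 1) (B 1 0)
    where
    interchange₀₀ : ∀ a b x y → a * (y * 1) + b * (x * 1) ≡ x * (b * 1) + y * (a * 1)
    interchange₀₀ = solve-∀
  pathsByFirstStep-last A B zero (suc d) =
    trans (cong₂ (λ u v → A 0 0 * u + B 0 0 * v)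
                 (pathsByFirstStep-lastʸ (A ↑ˣ) (B ↑ˣ) (suc d))
                 (pathsByFirstStep-last (A ↑ʸ) (B ↑ʸ) zero d))
          (interchange (A 0 0) (B 0 0) (A 0 (suc (suc d))) (B 1 (suc d))
             (P (A ↑ˣ) (B ↑ˣ) 0 (suc d)) (P (A ↑ʸ) (B ↑ʸ) 0 (suc d)) (P (A ↑ʸ) (B ↑ʸ) 1 d))
    where
    interchange : ∀ a b x y q r s → a * (y * q) + b * (x * r + y * s) ≡ x * (b * r) + y * (a * q + b * s)
    interchange = solve-∀
  pathsByFirstStep-last A B (suc c) zero =
    trans (cong₂ (λ u v → A 0 0 * u + B 0 0 * v)
                 (pathsByFirstStep-last (A ↑ˣ) (B ↑ˣ) c zero)
                 (pathsByFirstStep-lastˣ (A ↑ʸ) (B ↑ʸ) (suc c)))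
          (interchange (A 0 0) (B 0 0) (A (suc c) 1) (B (suc (suc c)) 0)
             (P (A ↑ˣ) (B ↑ˣ) c 1) (P (A ↑ˣ) (B ↑ˣ) (suc c) 0) (P (A ↑ʸ) (B ↑ʸ) (suc c) 0))
    where
    interchange : ∀ a b x y p q r → a * (x * p + y * q) + b * (x * r) ≡ x * (a * p + b * r) + y * (a * q)
    interchange = solve-∀
  pathsByFirstStep-last A B (suc c) (suc d) =
    trans (cong₂ (λ u v → A 0 0 * u + B 0 0 * v)
                 (pathsByFirstStep-last (A ↑ˣ) (B ↑ˣ) c (suc d))
                 (pathsByFirstStep-last (A ↑ʸ) (B ↑ʸ) (suc c) d))
          (interchange (A 0 0) (B 0 0) (A (suc c) (suc (suc d))) (B (suc (suc c)) (suc d))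
             (P (A ↑ˣ) (B ↑ˣ) c (suc (suc d))) (P (A ↑ˣ) (B ↑ˣ) (suc c) (suc d))
             (P (A ↑ʸ) (B ↑ʸ) (suc c) (suc d)) (P (A ↑ʸ) (B ↑ʸ) (suc (suc c)) d))
    where
    interchange : ∀ a b x y p q r s → a * (x * p + y * q) + b * (x * r + y * s) ≡ x * (a * p + b * r) + y * (a * q + b * s)
    interchange = solve-∀

  pathsByFirstStep≡paths : ∀ A B c d → pathsByFirstStep A B c d ≡ paths A B c d
  pathsByFirstStep≡paths A B zero    zero    = refl
  pathsByFirstStep≡paths A B (suc c) zero    =
    trans (pathsByFirstStep-lastˣ A B c) (cong (A c 0 *_) (pathsByFirstStep≡paths A B c 0))
  pathsByFirstStep≡paths A B zero    (suc d) =
    trans (pathsByFirstStep-lastʸ A B d) (cong (B 0 d *_) (pathsByFirstStep≡paths A B 0 d))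
  pathsByFirstStep≡paths A B (suc c) (suc d) =
    trans (pathsByFirstStep-last A B c d)
          (cong₂ (λ u v → A c (suc d) * u + B (suc c) d * v)
                 (pathsByFirstStep≡paths A B c (suc d)) (pathsByFirstStep≡paths A B (suc c) d))

  DiagonallyInvariant : ℕ → Weight → Set
  DiagonallyInvariant s A = ∀ x y → A (x + s) (y + s) ≡ A x y

  diagonallyInvariant-+ : ∀ {s t A} → DiagonallyInvariant s A → DiagonallyInvariant t A → DiagonallyInvariant (s + t) A
  diagonallyInvariant-+ {s} {t} {A} inv-s inv-t x y = begin
    A (x + (s + t)) (y + (s + t)) ≡⟨ cong₂ A (sym (+-assoc x s t)) (sym (+-assoc y s t)) ⟩
    A (x + s + t) (y + s + t)     ≡⟨ inv-t (x + s) (y + s) ⟩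
    A (x + s) (y + s)             ≡⟨ inv-s x y ⟩
    A x y                         ∎
    where open ≡-Reasoning

  module ShiftRecurrence (A B : Weight) (s t k l : ℕ)
    (A-inv-s : DiagonallyInvariant s A) (A-inv-t : DiagonallyInvariant t A)
    (B-inv-s : DiagonallyInvariant s B) (B-inv-t : DiagonallyInvariant t B) where

    ShiftRelation : ℕ → ℕ → Set
    ShiftRelation i j = paths A B (i + t) (j + t) + k * paths A B i j ≡ l * paths A B (i + s) (j + s)

    private
      combine : ∀ g h X₀ X₁ X₂ Y₀ Y₁ Y₂ → X₂ + k * X₀ ≡ l * X₁ → Y₂ + k * Y₀ ≡ l * Y₁ →
                (g * X₂ + h * Y₂) + k * (g * X₀ + h * Y₀) ≡ l * (g * X₁ + h * Y₁)
      combine g h X₀ X₁ X₂ Y₀ Y₁ Y₂ relX relY = begin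
        (g * X₂ + h * Y₂) + k * (g * X₀ + h * Y₀) ≡⟨ distribute g h k X₀ X₂ Y₀ Y₂ ⟩
        g * (X₂ + k * X₀) + h * (Y₂ + k * Y₀)     ≡⟨ cong₂ (λ u v → g * u + h * v) relX relY ⟩
        g * (l * X₁) + h * (l * Y₁)               ≡⟨ collect g h l X₁ Y₁ ⟩
        l * (g * X₁ + h * Y₁)                     ∎
        where
        open ≡-Reasoning
        distribute : ∀ g h k X₀ X₂ Y₀ Y₂ → (g * X₂ + h * Y₂) + k * (g * X₀ + h * Y₀) ≡ g * (X₂ + k * X₀) + h * (Y₂ + k * Y₀)
        distribute = solve-∀
        collect : ∀ g h l X₁ Y₁ → g * (l * X₁) + h * (l * Y₁) ≡ l * (g * X₁ + h * Y₁)
        collect = solve-∀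

    shiftRelation-step : ∀ i j → ShiftRelation i (suc j) → ShiftRelation (suc i) j → ShiftRelation (suc i) (suc j)
    shiftRelation-step i j relX relY = begin
      (A (i + t) (suc j + t) * F (i + t) (suc j + t) + B (suc i + t) (j + t) * F (suc i + t) (j + t))
        + k * (A i (suc j) * F i (suc j) + B (suc i) j * F (suc i) j)
        ≡⟨ cong₂ (λ g h → (g * F (i + t) (suc j + t) + h * F (suc i + t) (j + t))
                            + k * (A i (suc j) * F i (suc j) + B (suc i) j * F (suc i) j))
                 (A-inv-t i (suc j)) (B-inv-t (suc i) j) ⟩
      (A i (suc j) * F (i + t) (suc j + t) + B (suc i) j * F (suc i + t) (j + t))
        + k * (A i (suc j) * F i (suc j) + B (suc i) j * F (suc i) j)
        ≡⟨ combine (A i (suc j)) (B (suc i) j) _ _ _ _ _ _ relX relY ⟩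
      l * (A i (suc j) * F (i + s) (suc j + s) + B (suc i) j * F (suc i + s) (j + s))
        ≡⟨ cong₂ (λ g h → l * (g * F (i + s) (suc j + s) + h * F (suc i + s) (j + s)))
                 (sym (A-inv-s i (suc j))) (sym (B-inv-s (suc i) j)) ⟩
      l * F (suc i + s) (suc j + s) ∎
      where
      open ≡-Reasoning
      F : ℕ → ℕ → ℕ
      F = paths A B

    shiftRelation-from-boundary : (∀ j → ShiftRelation 0 (suc j)) → (∀ i → ShiftRelation (suc i) 0) →
                                  ∀ i j → ShiftRelation (suc i) (suc j)
    shiftRelation-from-boundary column row = go
      where
      go : ∀ i j → ShiftRelation (suc i) (suc j)
      go zero    zero    = shiftRelation-step 0 0 (column 0) (row 0)
      go zero    (suc j) = shiftRelation-step 0 (suc j) (column (suc j)) (go zero j)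
      go (suc i) zero    = shiftRelation-step (suc i) 0 (go i zero) (row (suc i))
      go (suc i) (suc j) = shiftRelation-step (suc i) (suc j) (go i (suc j)) (go (suc i) j)

module LinearExtensionCounting where

  open import Data.Bool using (Bool; true; false; _∧_)
  open import Data.List using (List; []; _∷_; _++_; map; concatMap; length; filter)
  open import Data.List.Membership.Propositional using (_∈_; find)
  open import Data.List.Membership.Propositional.Properties using (∈-concatMap⁻; map∷⁻)
  open import Data.List.Properties using (map-++; map-cong-local; map-∘)
  open import Data.List.Relation.Binary.Permutation.Propositional as ↭ using (_↭_; ↭-sym)
  open import Data.List.Relation.Binary.Permutation.Propositional.Properties using (All-resp-↭)
  open import Data.List.Relation.Unary.All as All using (All; []; _∷_; all?)
  open import Data.List.Relation.Unary.AllPairs using (AllPairs; []; _∷_; allPairs?)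
  open import Data.List.Relation.Unary.Any using (here; there)
  open import Data.Nat using (ℕ; suc; _+_; _*_)
  open import Data.Nat.ListAction using (sum)
  open import Data.Nat.ListAction.Properties using (sum-++)
  open import Data.Nat.Properties using (+-identityʳ; +-assoc; *-zeroʳ; *-identityˡ; *-distribˡ-+)
  open import Data.Nat.Tactic.RingSolver using (solve-∀)
  open import Data.Product using (_,_)
  open import Defs using (insertions; permutations)
  open import Function using (_∘_; const)
  open import Relation.Binary.Definitions using (Decidable)
  open import Relation.Binary.PropositionalEquality
  open import Relation.Nullary using (¬_; Dec; yes; no; does)
  open import Relation.Nullary.Decidable using (¬?; does-⇔; dec-true; dec-false)
  open import Function.Bundles using (mk⇔)

  𝟙 : Bool → ℕ
  𝟙 true  = 1
  𝟙 false = 0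

  𝟙-∧ : ∀ u v → 𝟙 (u ∧ v) ≡ 𝟙 u * 𝟙 v
  𝟙-∧ true  v = sym (+-identityʳ (𝟙 v))
  𝟙-∧ false v = refl

  𝟙-idem : ∀ u → 𝟙 u * 𝟙 u ≡ 𝟙 u
  𝟙-idem true  = refl
  𝟙-idem false = refl

  module _ {A : Set} where

    sum-map-cong : ∀ {f g : A → ℕ} xs → (∀ {x} → x ∈ xs → f x ≡ g x) → sum (map f xs) ≡ sum (map g xs)
    sum-map-cong xs f≡g = cong sum (map-cong-local (All.tabulate f≡g))

    sum-map-+ : ∀ (f g : A → ℕ) xs → sum (map (λ x → f x + g x) xs) ≡ sum (map f xs) + sum (map g xs)
    sum-map-+ f g []       = refl
    sum-map-+ f g (x ∷ xs) = trans (cong (f x + g x +_) (sum-map-+ f g xs))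
                             (interchange (f x) (g x) (sum (map f xs)) (sum (map g xs)))
      where
      interchange : ∀ p q r s → (p + q) + (r + s) ≡ (p + r) + (q + s)
      interchange = solve-∀

    sum-map-* : ∀ k (f : A → ℕ) xs → sum (map (λ x → k * f x) xs) ≡ k * sum (map f xs)
    sum-map-* k f []       = sym (*-zeroʳ k)
    sum-map-* k f (x ∷ xs) = trans (cong (k * f x +_) (sum-map-* k f xs)) (sym (*-distribˡ-+ k (f x) _))

    sum-map-zero : ∀ (f : A → ℕ) xs → (∀ {x} → x ∈ xs → f x ≡ 0) → sum (map f xs) ≡ 0
    sum-map-zero f []       f≡0 = refl
    sum-map-zero f (x ∷ xs) f≡0 = cong₂ _+_ (f≡0 (here refl)) (sum-map-zero f xs (f≡0 ∘ there))

    sum-map-concatMap : ∀ {B : Set} (g : B → ℕ) (h : A → List B) xs →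
      sum (map g (concatMap h xs)) ≡ sum (map (λ x → sum (map g (h x))) xs)
    sum-map-concatMap g h []       = refl
    sum-map-concatMap g h (x ∷ xs) = begin
      sum (map g (h x ++ concatMap h xs))         ≡⟨ cong sum (map-++ g (h x) (concatMap h xs)) ⟩
      sum (map g (h x) ++ map g (concatMap h xs)) ≡⟨ sum-++ (map g (h x)) _ ⟩
      sum (map g (h x)) + sum (map g (concatMap h xs)) ≡⟨ cong (sum (map g (h x)) +_) (sum-map-concatMap g h xs) ⟩
      sum (map g (h x)) + sum (map (λ x → sum (map g (h x))) xs) ∎
      where open ≡-Reasoning

    insertions-↭ : ∀ (y : A) p {q} → q ∈ insertions y p → q ↭ y ∷ p
    insertions-↭ y []       (here refl) = ↭.refl
    insertions-↭ y (z ∷ zs) (here refl) = ↭.refl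
    insertions-↭ y (z ∷ zs) (there q∈) with map∷⁻ q∈
    ... | q , q∈′ , refl = ↭.trans (↭.prep z (insertions-↭ y zs q∈′)) (↭.swap z y ↭.refl)

    permutations-↭ : ∀ (L : List A) {p} → p ∈ permutations L → p ↭ L
    permutations-↭ []       (here refl) = ↭.refl
    permutations-↭ (y ∷ ys) p∈ with find (∈-concatMap⁻ (insertions y) {xs = permutations ys} p∈)
    ... | q , q∈ , p∈′ = ↭.trans (insertions-↭ y q p∈′) (↭.prep y (permutations-↭ ys q∈))

    -- The sum of F x r over the ways of removing one entry x from L, leaving r in order.
    sumPicks : List A → (A → List A → ℕ) → ℕ
    sumPicks []       F = 0
    sumPicks (y ∷ ys) F = F y ys + sumPicks ys (λ x r → F x (y ∷ r))

    sumPicks-cong : ∀ L {F G} → (∀ {x} r → x ∈ L → F x r ≡ G x r) → sumPicks L F ≡ sumPicks L G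
    sumPicks-cong []       F≡G = refl
    sumPicks-cong (y ∷ ys) F≡G = cong₂ _+_ (F≡G ys (here refl)) (sumPicks-cong ys (λ r → F≡G (y ∷ r) ∘ there))

    sumPicks-+ : ∀ L F G → sumPicks L (λ x r → F x r + G x r) ≡ sumPicks L F + sumPicks L G
    sumPicks-+ []       F G = refl
    sumPicks-+ (y ∷ ys) F G =
      trans (cong (F y ys + G y ys +_) (sumPicks-+ ys (λ x r → F x (y ∷ r)) (λ x r → G x (y ∷ r))))
            (interchange (F y ys) (G y ys) (sumPicks ys (λ x r → F x (y ∷ r))) (sumPicks ys (λ x r → G x (y ∷ r))))
      where
      interchange : ∀ p q r s → (p + q) + (r + s) ≡ (p + r) + (q + s)
      interchange = solve-∀

    sumPicks-++ : ∀ xs ys F → sumPicks (xs ++ ys) F ≡ sumPicks xs (λ x r → F x (r ++ ys)) + sumPicks ys (λ x r → F x (xs ++ r))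
    sumPicks-++ []       ys F = refl
    sumPicks-++ (u ∷ us) ys F =
      trans (cong (F u (us ++ ys) +_) (sumPicks-++ us ys (λ x r → F x (u ∷ r))))
            (sym (+-assoc (F u (us ++ ys)) _ _))

    sumPicks-zero : ∀ L F → (∀ {x} r → x ∈ L → F x r ≡ 0) → sumPicks L F ≡ 0
    sumPicks-zero []       F F≡0 = refl
    sumPicks-zero (y ∷ ys) F F≡0 =
      cong₂ _+_ (F≡0 ys (here refl)) (sumPicks-zero ys _ (λ r → F≡0 (y ∷ r) ∘ there))

  module LinearExtensions {A : Set} {_≤_ : A → A → Set} (_≤?_ : Decidable _≤_) where

    Respects : List A → Set
    Respects = AllPairs (λ x y → ¬ y ≤ x)

    respects? : ∀ p → Dec (Respects p)
    respects? = allPairs? (λ x y → ¬? (y ≤? x))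

    Precedes : A → List A → Set
    Precedes x = All (λ z → ¬ z ≤ x)

    precedes? : ∀ x p → Dec (Precedes x p)
    precedes? x = all? (λ z → ¬? (z ≤? x))

    count : List A → ℕ
    count L = length (filter respects? (permutations L))

    𝟙-respects : List A → ℕ
    𝟙-respects p = 𝟙 (does (respects? p))

    𝟙-precedes : A → List A → ℕ
    𝟙-precedes x p = 𝟙 (does (precedes? x p))

    𝟙-respects-∷ : ∀ x p → 𝟙-respects (x ∷ p) ≡ 𝟙-precedes x p * 𝟙-respects p
    𝟙-respects-∷ x p = 𝟙-∧ (does (precedes? x p)) (does (respects? p))

    𝟙-respects-yes : ∀ {p} → Respects p → 𝟙-respects p ≡ 1
    𝟙-respects-yes {p} rp = cong 𝟙 (dec-true (respects? p) rp)

    𝟙-respects-no : ∀ {p} → ¬ Respects p → 𝟙-respects p ≡ 0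
    𝟙-respects-no {p} ¬rp = cong 𝟙 (dec-false (respects? p) ¬rp)

    𝟙-precedes-no : ∀ {x p} → ¬ Precedes x p → 𝟙-precedes x p ≡ 0
    𝟙-precedes-no {x} {p} ¬px = cong 𝟙 (dec-false (precedes? x p) ¬px)

    𝟙-precedes-↭ : ∀ x {p q} → p ↭ q → 𝟙-precedes x p ≡ 𝟙-precedes x q
    𝟙-precedes-↭ x {p} {q} p↭q =
      cong 𝟙 (does-⇔ (mk⇔ (All-resp-↭ p↭q) (All-resp-↭ (↭-sym p↭q))) (precedes? x p) (precedes? x q))

    Respects-insertions⁻ : ∀ y p {q} → q ∈ insertions y p → Respects q → Respects p
    Respects-insertions⁻ y []       _           _             = []
    Respects-insertions⁻ y (z ∷ zs) (here refl) (_ ∷ rzs)     = rzs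
    Respects-insertions⁻ y (z ∷ zs) (there q∈)  rq with map∷⁻ q∈
    Respects-insertions⁻ y (z ∷ zs) (there q∈)  (zq ∷ rq) | q , q∈′ , refl with All-resp-↭ (insertions-↭ y zs q∈′) zq
    ... | _ ∷ zzs = zzs ∷ Respects-insertions⁻ y zs q∈′ rq

    extensionSum : List A → (List A → ℕ) → ℕ
    extensionSum L w = sum (map (λ p → 𝟙-respects p * w p) (permutations L))

    extensionSum-cong : ∀ L {v w} → (∀ {p} → p ∈ permutations L → Respects p → v p ≡ w p) →
                        extensionSum L v ≡ extensionSum L w
    extensionSum-cong L {v} {w} v≡w = sum-map-cong (permutations L) pointwise
      where
      pointwise : ∀ {p} → p ∈ permutations L → 𝟙-respects p * v p ≡ 𝟙-respects p * w p
      pointwise {p} p∈ with respects? p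
      ... | yes rp = cong (1 *_) (v≡w p∈ rp)
      ... | no _   = refl

    extensionSum-+ : ∀ L v w → extensionSum L (λ p → v p + w p) ≡ extensionSum L v + extensionSum L w
    extensionSum-+ L v w =
      trans (sum-map-cong (permutations L) (λ {p} _ → *-distribˡ-+ (𝟙-respects p) (v p) (w p)))
            (sum-map-+ (λ p → 𝟙-respects p * v p) (λ p → 𝟙-respects p * w p) (permutations L))

    extensionSum-* : ∀ L k w → extensionSum L (λ p → k * w p) ≡ k * extensionSum L w
    extensionSum-* L k w =
      trans (sum-map-cong (permutations L) (λ {p} _ → x*[y*z]≡y*[x*z] (𝟙-respects p) k (w p)))
            (sum-map-* k (λ p → 𝟙-respects p * w p) (permutations L))
      where
      x*[y*z]≡y*[x*z] : ∀ x y z → x * (y * z) ≡ y * (x * z)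
      x*[y*z]≡y*[x*z] = solve-∀

    count≡extensionSum : ∀ L → count L ≡ extensionSum L (const 1)
    count≡extensionSum L = go (permutations L)
      where
      go : ∀ ps → length (filter respects? ps) ≡ sum (map (λ p → 𝟙-respects p * 1) ps)
      go []       = refl
      go (p ∷ ps) with does (respects? p)
      ... | true  = cong suc (go ps)
      ... | false = go ps

    insertionSum : A → List A → (List A → ℕ) → ℕ
    insertionSum y p w = sum (map (λ q → 𝟙-respects q * w q) (insertions y p))

    insertionSum-respects : ∀ y p w → insertionSum y p w ≡ 𝟙-respects p * insertionSum y p w
    insertionSum-respects y p w with respects? p
    ... | yes _  = sym (+-identityʳ _)
    ... | no ¬rp = sum-map-zero _ (insertions y p)
                     (λ {q} q∈ → cong (_* w q) (𝟙-respects-no (¬rp ∘ Respects-insertions⁻ y p q∈)))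

    extensionSum-∷ : ∀ y ys w → extensionSum (y ∷ ys) w ≡ extensionSum ys (λ p → insertionSum y p w)
    extensionSum-∷ y ys w =
      trans (sum-map-concatMap (λ p → 𝟙-respects p * w p) (insertions y) (permutations ys))
            (sum-map-cong (permutations ys) (λ {p} _ → insertionSum-respects y p w))

    insertionSum-∷ : ∀ y x p w → insertionSum y (x ∷ p) w ≡
      𝟙-respects (y ∷ x ∷ p) * w (y ∷ x ∷ p) + insertionSum y p (λ q → 𝟙-precedes x q * w (x ∷ q))
    insertionSum-∷ y x p w = cong (𝟙-respects (y ∷ x ∷ p) * w (y ∷ x ∷ p) +_) (begin
      sum (map (λ q → 𝟙-respects q * w q) (map (x ∷_) (insertions y p)))
        ≡⟨ cong sum (sym (map-∘ (insertions y p))) ⟩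
      sum (map (λ q → 𝟙-respects (x ∷ q) * w (x ∷ q)) (insertions y p))
        ≡⟨ sum-map-cong (insertions y p) (λ {q} _ → trans (cong (_* w (x ∷ q)) (𝟙-respects-∷ x q))
                                                          (x*y*z≡y*[x*z] (𝟙-precedes x q) (𝟙-respects q) (w (x ∷ q)))) ⟩
      insertionSum y p (λ q → 𝟙-precedes x q * w (x ∷ q)) ∎)
      where
      open ≡-Reasoning
      x*y*z≡y*[x*z] : ∀ x y z → x * y * z ≡ y * (x * z)
      x*y*z≡y*[x*z] = solve-∀

    insertionSum-precedes : ∀ y x p (v : List A → ℕ) →
      𝟙-precedes x p * insertionSum y p (λ q → 𝟙-precedes x q * v q) ≡ insertionSum y p (λ q → 𝟙-precedes x q * v q)
    insertionSum-precedes y x p v with precedes? x p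
    ... | yes _  = *-identityˡ _
    ... | no ¬px = sym (sum-map-zero (λ q → 𝟙-respects q * (𝟙-precedes x q * v q)) (insertions y p) vanishes)
      where
      vanishes : ∀ {q} → q ∈ insertions y p → 𝟙-respects q * (𝟙-precedes x q * v q) ≡ 0
      vanishes {q} q∈ =
        trans (cong (λ t → 𝟙-respects q * (t * v q))
                    (𝟙-precedes-no (λ pxq → ¬px (All.tail (All-resp-↭ (insertions-↭ y p q∈) pxq)))))
              (*-zeroʳ (𝟙-respects q))

    insertionSum-∷-precedes : ∀ y x p w → Respects p →
      𝟙-precedes x p * insertionSum y (x ∷ p) w ≡
      𝟙-precedes x p * (𝟙-precedes y (x ∷ p) * w (y ∷ x ∷ p)) + insertionSum y p (λ q → 𝟙-precedes x q * w (x ∷ q))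
    insertionSum-∷-precedes y x p w rp = begin
      a * insertionSum y (x ∷ p) w
        ≡⟨ cong (a *_) (insertionSum-∷ y x p w) ⟩
      a * (𝟙-respects (y ∷ x ∷ p) * W + S)
        ≡⟨ cong (λ t → a * (t * W + S)) respects-yxp ⟩
      a * (b * (a * 1) * W + S)
        ≡⟨ regroup a b W S ⟩
      (a * a) * (b * W) + a * S
        ≡⟨ cong₂ _+_ (cong (_* (b * W)) (𝟙-idem (does (precedes? x p)))) (insertionSum-precedes y x p (λ q → w (x ∷ q))) ⟩
      a * (b * W) + S ∎
      where
      open ≡-Reasoning
      a b W S : ℕ
      a = 𝟙-precedes x p
      b = 𝟙-precedes y (x ∷ p)
      W = w (y ∷ x ∷ p)
      S = insertionSum y p (λ q → 𝟙-precedes x q * w (x ∷ q))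
      respects-yxp : 𝟙-respects (y ∷ x ∷ p) ≡ b * (a * 1)
      respects-yxp = trans (𝟙-respects-∷ y (x ∷ p))
                           (cong (b *_) (trans (𝟙-respects-∷ x p) (cong (a *_) (𝟙-respects-yes rp))))
      regroup : ∀ a b W S → a * (b * (a * 1) * W + S) ≡ (a * a) * (b * W) + a * S
      regroup = solve-∀

    sumStartingWith : (List A → ℕ) → A → List A → ℕ
    sumStartingWith w x r = extensionSum r (λ p → 𝟙-precedes x p * w (x ∷ p))

    countStartingWith : A → List A → ℕ
    countStartingWith x r = 𝟙-precedes x r * count r

    -- The general weight makes the induction go through: inserting the head y into the orderings
    -- of the tail replaces w by insertionSum y.
    extensionSum-first : ∀ y ys w → extensionSum (y ∷ ys) w ≡ sumPicks (y ∷ ys) (sumStartingWith w)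
    extensionSum-first y []       w = singleton (w (y ∷ []))
      where
      singleton : ∀ W → 1 * W + 0 ≡ (1 * (1 * W) + 0) + 0
      singleton = solve-∀
    extensionSum-first y (z ∷ zs) w = begin
      extensionSum (y ∷ z ∷ zs) w
        ≡⟨ extensionSum-∷ y (z ∷ zs) w ⟩
      extensionSum (z ∷ zs) (λ p → insertionSum y p w)
        ≡⟨ extensionSum-first z zs (λ p → insertionSum y p w) ⟩
      sumPicks (z ∷ zs) (λ x r → extensionSum r (λ p → 𝟙-precedes x p * insertionSum y (x ∷ p) w))
        ≡⟨ sumPicks-cong (z ∷ zs) (λ r _ → trans (extensionSum-cong r (λ {p} _ rp → insertionSum-∷-precedes y _ p w rp))
                                                 (extensionSum-+ r _ _)) ⟩
      sumPicks (z ∷ zs) (λ x r → sumStartingWith (λ p → 𝟙-precedes y p * w (y ∷ p)) x r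
                               + extensionSum r (λ p → insertionSum y p (λ q → 𝟙-precedes x q * w (x ∷ q))))
        ≡⟨ sumPicks-+ (z ∷ zs) (sumStartingWith (λ p → 𝟙-precedes y p * w (y ∷ p)))
                     (λ x r → extensionSum r (λ p → insertionSum y p (λ q → 𝟙-precedes x q * w (x ∷ q)))) ⟩
      sumPicks (z ∷ zs) (sumStartingWith (λ p → 𝟙-precedes y p * w (y ∷ p)))
        + sumPicks (z ∷ zs) (λ x r → extensionSum r (λ p → insertionSum y p (λ q → 𝟙-precedes x q * w (x ∷ q))))
        ≡⟨ cong₂ _+_ (sym (extensionSum-first z zs (λ p → 𝟙-precedes y p * w (y ∷ p))))
                     (sumPicks-cong (z ∷ zs) (λ {x} r _ → sym (extensionSum-∷ y r (λ q → 𝟙-precedes x q * w (x ∷ q))))) ⟩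
      sumPicks (y ∷ z ∷ zs) (sumStartingWith w) ∎
      where open ≡-Reasoning

    count-first : ∀ y ys → count (y ∷ ys) ≡ sumPicks (y ∷ ys) countStartingWith
    count-first y ys = begin
      count (y ∷ ys)                                   ≡⟨ count≡extensionSum (y ∷ ys) ⟩
      extensionSum (y ∷ ys) (const 1)                  ≡⟨ extensionSum-first y ys (const 1) ⟩
      sumPicks (y ∷ ys) (sumStartingWith (const 1))    ≡⟨ sumPicks-cong (y ∷ ys) (λ {x} r _ → sumStartingWith-1 x r) ⟩
      sumPicks (y ∷ ys) countStartingWith              ∎
      where
      open ≡-Reasoning
      sumStartingWith-1 : ∀ x r → sumStartingWith (const 1) x r ≡ countStartingWith x r
      sumStartingWith-1 x r = begin
        extensionSum r (λ p → 𝟙-precedes x p * 1)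
          ≡⟨ extensionSum-cong r (λ {p} p∈ _ → cong (_* 1) (𝟙-precedes-↭ x (permutations-↭ r p∈))) ⟩
        extensionSum r (λ _ → 𝟙-precedes x r * 1)
          ≡⟨ extensionSum-* r (𝟙-precedes x r) (const 1) ⟩
        𝟙-precedes x r * extensionSum r (const 1)
          ≡⟨ cong (𝟙-precedes x r *_) (sym (count≡extensionSum r)) ⟩
        𝟙-precedes x r * count r ∎

    𝟙-precedes-∈ : ∀ {x z p} → z ∈ p → z ≤ x → 𝟙-precedes x p ≡ 0
    𝟙-precedes-∈ z∈p z≤x = 𝟙-precedes-no (λ px → All.lookup px z∈p z≤x)

module TwoChainPoset where

  open import Defs
  open import Data.Nat using (ℕ; suc; _+_; _≤_; _<_; _<?_; _%_; z≤n; s≤s; _≤′_; ≤′-refl; ≤′-step)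
  open import Data.Nat.DivMod using ([m+n]%n≡m%n)
  open import Data.Nat.Properties
  open import Data.Empty using (⊥-elim)
  open import Data.Product using (_×_; _,_)
  open import Data.Sum using (_⊎_; inj₁; inj₂)
  open import Relation.Binary.Definitions using (Reflexive; Transitive)
  open import Relation.Binary.PropositionalEquality
  open import Relation.Binary.Construct.Closure.ReflexiveTransitive using (ε; _◅_; _◅◅_; gmap; fold)
  open import Relation.Nullary using (yes; no)

  stepwise : ∀ {A : Set} {R : A → A → Set} → Reflexive R → Transitive R →
             (f : ℕ → A) → (∀ k → R (f k) (f (suc k))) → ∀ {k k′} → k ≤ k′ → R (f k) (f k′)
  stepwise {R = R} refl′ trans′ f step k≤k′ = go (≤⇒≤′ k≤k′)
    where
    go : ∀ {k k′} → k ≤′ k′ → R (f k) (f k′)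
    go ≤′-refl      = refl′
    go (≤′-step le) = trans′ (go le) (step _)

  -- β k is the largest l with b_l ≼ a_k and α l the largest k with a_k ≼ b_l (0 if there is none).
  β : ℕ → ℕ
  β 0 = 0
  β 1 = 0
  β 2 = 0
  β 3 = 0
  β 4 = 2
  β 5 = 2
  β 6 = 4
  β (suc (suc (suc (suc (suc (suc (suc k))))))) = 5 + β (suc (suc k))

  α : ℕ → ℕ
  α 0 = 0
  α 1 = 0
  α 2 = 1
  α 3 = 2
  α 4 = 3
  α 5 = 4
  α 6 = 4
  α (suc (suc (suc (suc (suc (suc (suc k))))))) = 5 + α (suc (suc k))

  β-mono-suc : ∀ k → β k ≤ β (suc k)
  β-mono-suc 0 = z≤n
  β-mono-suc 1 = z≤n
  β-mono-suc 2 = z≤n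
  β-mono-suc 3 = z≤n
  β-mono-suc 4 = ≤-refl
  β-mono-suc 5 = s≤s (s≤s z≤n)
  β-mono-suc 6 = s≤s (s≤s (s≤s (s≤s z≤n)))
  β-mono-suc (suc (suc (suc (suc (suc (suc (suc k))))))) = +-monoʳ-≤ 5 (β-mono-suc (suc (suc k)))

  α-mono-suc : ∀ k → α k ≤ α (suc k)
  α-mono-suc 0 = z≤n
  α-mono-suc 1 = z≤n
  α-mono-suc 2 = s≤s z≤n
  α-mono-suc 3 = s≤s (s≤s z≤n)
  α-mono-suc 4 = s≤s (s≤s (s≤s z≤n))
  α-mono-suc 5 = ≤-refl
  α-mono-suc 6 = s≤s (s≤s (s≤s (s≤s z≤n)))
  α-mono-suc (suc (suc (suc (suc (suc (suc (suc k))))))) = +-monoʳ-≤ 5 (α-mono-suc (suc (suc k)))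

  β-mono : ∀ {k k′} → k ≤ k′ → β k ≤ β k′
  β-mono = stepwise {R = _≤_} ≤-refl ≤-trans β β-mono-suc

  α-mono : ∀ {k k′} → k ≤ k′ → α k ≤ α k′
  α-mono = stepwise {R = _≤_} ≤-refl ≤-trans α α-mono-suc

  β≤id : ∀ k → β k ≤ k
  β≤id 0 = z≤n
  β≤id 1 = z≤n
  β≤id 2 = z≤n
  β≤id 3 = z≤n
  β≤id 4 = s≤s (s≤s z≤n)
  β≤id 5 = s≤s (s≤s z≤n)
  β≤id 6 = s≤s (s≤s (s≤s (s≤s z≤n)))
  β≤id (suc (suc (suc (suc (suc (suc (suc k))))))) = +-monoʳ-≤ 5 (β≤id (suc (suc k)))

  α≤id : ∀ k → α k ≤ k
  α≤id 0 = z≤n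
  α≤id 1 = z≤n
  α≤id 2 = s≤s z≤n
  α≤id 3 = s≤s (s≤s z≤n)
  α≤id 4 = s≤s (s≤s (s≤s z≤n))
  α≤id 5 = s≤s (s≤s (s≤s (s≤s z≤n)))
  α≤id 6 = s≤s (s≤s (s≤s (s≤s z≤n)))
  α≤id (suc (suc (suc (suc (suc (suc (suc k))))))) = +-monoʳ-≤ 5 (α≤id (suc (suc k)))

  %5-periodic : ∀ n → (5 + n) % 5 ≡ n % 5
  %5-periodic n = trans (cong (_% 5) (+-comm 5 n)) ([m+n]%n≡m%n n 5)

  CondA-+5 : ∀ {n} → CondA n → CondA (5 + n)
  CondA-+5 {n} c e = c (trans (sym (%5-periodic n)) e)

  CondA-∸5 : ∀ {n} → CondA (5 + n) → CondA n
  CondA-∸5 {n} c e = c (trans (%5-periodic n) e)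

  CondB-+5 : ∀ {n} → CondB n → CondB (5 + n)
  CondB-+5 {n} = subst (λ r → (r ≡ 0) ⊎ ((r ≡ 2) ⊎ (r ≡ 4))) (sym (%5-periodic n))

  CondB-∸5 : ∀ {n} → CondB (5 + n) → CondB n
  CondB-∸5 {n} = subst (λ r → (r ≡ 0) ⊎ ((r ≡ 2) ⊎ (r ≡ 4))) (%5-periodic n)

  CondA⇒≤α : ∀ n → CondA n → n ≤ α (suc n)
  CondA⇒≤α 0 c = ⊥-elim (c refl)
  CondA⇒≤α 1 _ = s≤s z≤n
  CondA⇒≤α 2 _ = s≤s (s≤s z≤n)
  CondA⇒≤α 3 _ = s≤s (s≤s (s≤s z≤n))
  CondA⇒≤α 4 _ = s≤s (s≤s (s≤s (s≤s z≤n)))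
  CondA⇒≤α 5 c = ⊥-elim (c refl)
  CondA⇒≤α (suc (suc (suc (suc (suc (suc n)))))) c = +-monoʳ-≤ 5 (CondA⇒≤α (suc n) (CondA-∸5 {suc n} c))

  CondB⇒≤β : ∀ n → CondB n → n ≤ β (suc (suc n))
  CondB⇒≤β 0 _ = z≤n
  CondB⇒≤β 1 (inj₁ ())
  CondB⇒≤β 1 (inj₂ (inj₁ ()))
  CondB⇒≤β 1 (inj₂ (inj₂ ()))
  CondB⇒≤β 2 _ = s≤s (s≤s z≤n)
  CondB⇒≤β 3 (inj₁ ())
  CondB⇒≤β 3 (inj₂ (inj₁ ()))
  CondB⇒≤β 3 (inj₂ (inj₂ ()))
  CondB⇒≤β 4 _ = s≤s (s≤s (s≤s (s≤s z≤n)))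
  CondB⇒≤β (suc (suc (suc (suc (suc n))))) c = +-monoʳ-≤ 5 (CondB⇒≤β n (CondB-∸5 {n} c))

  ≼-mono : (h : Elem → ℕ) → (∀ {x y} → Gen x y → h x ≤ h y) → ∀ {x y} → x ≼ y → h x ≤ h y
  ≼-mono h step = fold (λ x y → h x ≤ h y) (λ g le → ≤-trans (step g) le) ≤-refl

  aIndex : Elem → ℕ
  aIndex (a k) = k
  aIndex (b l) = α l

  bIndex : Elem → ℕ
  bIndex (a k) = β k
  bIndex (b l) = l

  aIndex-mono : ∀ {x y} → x ≼ y → aIndex x ≤ aIndex y
  aIndex-mono = ≼-mono aIndex step
    where
    step : ∀ {x y} → Gen x y → aIndex x ≤ aIndex y
    step (a↑ i)   = n≤1+n _
    step (b↑ j)   = α-mono-suc (suc j)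
    step (ab i c) = CondA⇒≤α (suc i) c
    step (ba j c) = ≤-trans (α≤id (suc j)) (≤-trans (n≤1+n _) (n≤1+n _))

  bIndex-mono : ∀ {x y} → x ≼ y → bIndex x ≤ bIndex y
  bIndex-mono = ≼-mono bIndex step
    where
    step : ∀ {x y} → Gen x y → bIndex x ≤ bIndex y
    step (a↑ i)   = β-mono-suc (suc i)
    step (b↑ j)   = n≤1+n _
    step (ab i c) = ≤-trans (β≤id (suc i)) (n≤1+n _)
    step (ba j c) = CondB⇒≤β (suc j) c

  shift : Elem → Elem
  shift (a i) = a (5 + i)
  shift (b j) = b (5 + j)

  shift-≼ : ∀ {x y} → x ≼ y → shift x ≼ shift y
  shift-≼ = gmap shift shift-Gen
    where
    shift-Gen : ∀ {x y} → Gen x y → Gen (shift x) (shift y)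
    shift-Gen (a↑ i)   = a↑ (5 + i)
    shift-Gen (b↑ j)   = b↑ (5 + j)
    shift-Gen (ab i c) = ab (5 + i) (CondA-+5 {suc i} c)
    shift-Gen (ba j c) = ba (5 + j) (CondB-+5 {suc j} c)

  a-chain : ∀ {k k′} → 1 ≤ k → k ≤ k′ → a k ≼ a k′
  a-chain {suc k} {suc k′} _ (s≤s k≤k′) = stepwise {R = _≼_} ε _◅◅_ (λ i → a (suc i)) (λ i → a↑ i ◅ ε) k≤k′

  b-chain : ∀ {k k′} → 1 ≤ k → k ≤ k′ → b k ≼ b k′
  b-chain {suc k} {suc k′} _ (s≤s k≤k′) = stepwise {R = _≼_} ε _◅◅_ (λ j → b (suc j)) (λ j → b↑ j ◅ ε) k≤k′

  1≤β : ∀ k → 1 ≤ β (4 + k)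
  1≤β k = ≤-trans (s≤s z≤n) (β-mono (m≤m+n 4 k))

  1≤α : ∀ k → 1 ≤ α (2 + k)
  1≤α k = α-mono (m≤m+n 2 k)

  b[β]≼a : ∀ k → 1 ≤ β k → b (β k) ≼ a k
  b[β]≼a 4 _ = ba 1 (inj₂ (inj₁ refl)) ◅ ε
  b[β]≼a 5 _ = ba 1 (inj₂ (inj₁ refl)) ◅ a↑ 3 ◅ ε
  b[β]≼a 6 _ = ba 3 (inj₂ (inj₂ refl)) ◅ ε
  b[β]≼a 7 _ = ba 4 (inj₁ refl) ◅ ε
  b[β]≼a 8 _ = ba 4 (inj₁ refl) ◅ a↑ 6 ◅ ε
  b[β]≼a (suc (suc (suc (suc (suc (suc (suc (suc (suc k))))))))) _ = shift-≼ (b[β]≼a (suc (suc (suc (suc k)))) (1≤β k))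

  a[α]≼b : ∀ l → 1 ≤ α l → a (α l) ≼ b l
  a[α]≼b 2 _ = ab 0 (λ ()) ◅ ε
  a[α]≼b 3 _ = ab 1 (λ ()) ◅ ε
  a[α]≼b 4 _ = ab 2 (λ ()) ◅ ε
  a[α]≼b 5 _ = ab 3 (λ ()) ◅ ε
  a[α]≼b 6 _ = ab 3 (λ ()) ◅ b↑ 4 ◅ ε
  a[α]≼b (suc (suc (suc (suc (suc (suc (suc l))))))) _ = shift-≼ (a[α]≼b (suc (suc l)) (1≤α l))

  ≤β⇒b≼a : ∀ {k l} → 1 ≤ l → l ≤ β k → b l ≼ a k
  ≤β⇒b≼a {k} 1≤l l≤β = b-chain 1≤l l≤β ◅◅ b[β]≼a k (≤-trans 1≤l l≤β)

  ≤α⇒a≼b : ∀ {l k} → 1 ≤ k → k ≤ α l → a k ≼ b l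
  ≤α⇒a≼b {l} 1≤k k≤α = a-chain 1≤k k≤α ◅◅ a[α]≼b l (≤-trans 1≤k k≤α)

  β-periodic : ∀ k → β (suc (suc k) + 5) ≡ β (suc (suc k)) + 5
  β-periodic k = trans (cong (λ t → β (suc (suc t))) (+-comm k 5)) (+-comm 5 (β (suc (suc k))))

  α-periodic : ∀ k → α (suc (suc k) + 5) ≡ α (suc (suc k)) + 5
  α-periodic k = trans (cong (λ t → α (suc (suc t))) (+-comm k 5)) (+-comm 5 (α (suc (suc k))))

  β-+5 : ∀ k → β (k + 5) ≤ β k + 5
  β-+5 0             = s≤s (s≤s z≤n)
  β-+5 1             = n≤1+n 4
  β-+5 (suc (suc k)) = ≤-reflexive (β-periodic k)

  α-+5 : ∀ k → α (k + 5) ≤ α k + 5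
  α-+5 0             = n≤1+n 4
  α-+5 1             = n≤1+n 4
  α-+5 (suc (suc k)) = ≤-reflexive (α-periodic k)

  admissible⇒β< : ∀ {m n} → 1 ≤ m → Admissible m n → β m < n
  admissible⇒β< {m} {n} 1≤m adm with β m <? n
  ... | yes β<n = β<n
  ... | no  β≮n = ⊥-elim (adm (a m , (1≤m , ≤-refl) , below))
    where
    below : ∀ y → InP m n y → y ≼ a m
    below (a k) (1≤k , k≤m) = a-chain 1≤k k≤m
    below (b l) (1≤l , l≤n) = ≤β⇒b≼a 1≤l (≤-trans l≤n (≮⇒≥ β≮n))

  admissible⇒α< : ∀ {m n} → 1 ≤ n → Admissible m n → α n < m
  admissible⇒α< {m} {n} 1≤n adm with α n <? m
  ... | yes α<m = α<m
  ... | no  α≮m = ⊥-elim (adm (b n , (1≤n , ≤-refl) , below))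
    where
    below : ∀ y → InP m n y → y ≼ b n
    below (a k) (1≤k , k≤m) = ≤α⇒a≼b 1≤k (≤-trans k≤m (≮⇒≥ α≮m))
    below (b l) (1≤l , l≤n) = b-chain 1≤l l≤n

  TopsIncomparable : ℕ → ℕ → Set
  TopsIncomparable m n = β m < n × α n < m

  tops-+5 : ∀ {m n} → TopsIncomparable m n → TopsIncomparable (m + 5) (n + 5)
  tops-+5 {m} {n} (β<n , α<m) = ≤-<-trans (β-+5 m) (+-monoˡ-< 5 β<n) , ≤-<-trans (α-+5 n) (+-monoˡ-< 5 α<m)

  tops-+10 : ∀ {m n} → TopsIncomparable m n → TopsIncomparable (m + 10) (n + 10)
  tops-+10 {m} {n} tops = subst₂ TopsIncomparable (+-assoc m 5 5) (+-assoc n 5 5) (tops-+5 (tops-+5 tops))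

  admissible⇒tops : ∀ {m n} → 1 ≤ m → 1 ≤ n → Admissible m n → TopsIncomparable m n
  admissible⇒tops 1≤m 1≤n adm = admissible⇒β< 1≤m adm , admissible⇒α< 1≤n adm

module ExtensionCounts where
  open import Defs
  open LatticePaths
  open LinearExtensionCounting
  open TwoChainPoset

  open import Data.Nat using (ℕ; zero; suc; _+_; _*_; _≤_; _<_; _≤?_; z≤n; s≤s)
  open import Data.Nat.Properties
  open import Data.List using (List; []; _∷_; _++_; map; applyUpTo)
  open import Data.List.Membership.Propositional using (_∈_)
  open import Data.List.Membership.Propositional.Properties using (∈-++⁺ʳ)
  open import Data.List.Relation.Unary.All as All using (All)
  open import Data.List.Relation.Unary.All.Properties using (++⁺)
  open import Data.List.Relation.Unary.Any using (here; there)
  open import Data.Product using (_×_; _,_; proj₁; proj₂; ∃-syntax)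
  open import Data.Empty using (⊥-elim)
  open import Function using (_∘_)
  open import Function.Bundles using (_⇔_; mk⇔)
  open import Relation.Binary.PropositionalEquality
  open import Relation.Nullary using (¬_; yes; no; does)
  open import Relation.Nullary.Decidable using (does-⇔; dec-false)
  open LinearExtensions _≼?_ using (count; Precedes; precedes?; countStartingWith; 𝟙-precedes-∈; count-first)

  run : (ℕ → Elem) → ℕ → ℕ → List Elem
  run f i zero    = []
  run f i (suc c) = f (suc i) ∷ run f (suc i) c

  ∈-run⁻ : ∀ f i c {x} → x ∈ run f i c → ∃[ k ] (i < k × x ≡ f k)
  ∈-run⁻ f i (suc c) (here refl) = suc i , ≤-refl , refl
  ∈-run⁻ f i (suc c) (there x∈) with ∈-run⁻ f (suc i) c x∈
  ... | k , i<k , x≡fk = k , ≤-trans (n≤1+n _) i<k , x≡fk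

  map-applyUpTo≡run : ∀ f (h : ℕ → ℕ) i c → (∀ k → h k ≡ i + k) → map (λ k → f (suc k)) (applyUpTo h c) ≡ run f i c
  map-applyUpTo≡run f h i zero    h≡ = refl
  map-applyUpTo≡run f h i (suc c) h≡ =
    cong₂ _∷_ (cong (λ k → f (suc k)) (trans (h≡ 0) (+-identityʳ i)))
              (map-applyUpTo≡run f (λ k → h (suc k)) (suc i) c (λ k → trans (h≡ (suc k)) (+-suc i k)))

  elems≡runs : ∀ m n → elems m n ≡ run a 0 m ++ run b 0 n
  elems≡runs m n = cong₂ _++_ (map-applyUpTo≡run a (λ k → k) 0 m (λ _ → refl))
                              (map-applyUpTo≡run b (λ k → k) 0 n (λ _ → refl))

  countStartingWithᵃ : ℕ → ℕ → ℕ → ℕ → ℕ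
  countStartingWithᵃ i zero    j d = 0
  countStartingWithᵃ i (suc c) j d = countStartingWith (a (suc i)) (run a (suc i) c ++ run b j d)

  countStartingWithᵇ : ℕ → ℕ → ℕ → ℕ → ℕ
  countStartingWithᵇ i c j zero    = 0
  countStartingWithᵇ i c j (suc d) = countStartingWith (b (suc j)) (run a i c ++ run b (suc j) d)

  sumPicks-runs : ∀ i c j d → sumPicks (run a i c ++ run b j d) countStartingWith ≡ countStartingWithᵃ i c j d + countStartingWithᵇ i c j d
  sumPicks-runs i c j d =
    trans (sumPicks-++ (run a i c) (run b j d) countStartingWith) (cong₂ _+_ (fromA c) (fromB d))
    where
    fromA : ∀ c → sumPicks (run a i c) (λ x r → countStartingWith x (r ++ run b j d)) ≡ countStartingWithᵃ i c j d
    fromA zero    = refl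
    fromA (suc c) = trans (cong (countStartingWithᵃ i (suc c) j d +_) (sumPicks-zero (run a (suc i) c) _ blocked)) (+-identityʳ _)
      where
      blocked : ∀ {x} r → x ∈ run a (suc i) c → countStartingWith x (a (suc i) ∷ r ++ run b j d) ≡ 0
      blocked r x∈ with ∈-run⁻ a (suc i) c x∈
      ... | k , i<k , refl = cong (_* count (a (suc i) ∷ r ++ run b j d))
                                  (𝟙-precedes-∈ {p = a (suc i) ∷ r ++ run b j d} (here refl) (a-chain (s≤s z≤n) (<⇒≤ i<k)))
    fromB : ∀ d → sumPicks (run b j d) (λ x r → countStartingWith x (run a i c ++ r)) ≡ countStartingWithᵇ i c j d
    fromB zero    = refl
    fromB (suc d) = trans (cong (countStartingWithᵇ i c j (suc d) +_) (sumPicks-zero (run b (suc j) d) _ blocked)) (+-identityʳ _)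
      where
      blocked : ∀ {x} r → x ∈ run b (suc j) d → countStartingWith x (run a i c ++ b (suc j) ∷ r) ≡ 0
      blocked r x∈ with ∈-run⁻ b (suc j) d x∈
      ... | k , j<k , refl = cong (_* count (run a i c ++ b (suc j) ∷ r))
                                  (𝟙-precedes-∈ (∈-++⁺ʳ (run a i c) (here refl)) (b-chain (s≤s z≤n) (<⇒≤ j<k)))

  count-runs : ∀ i c j d → 1 ≤ c + d → count (run a i c ++ run b j d) ≡ countStartingWithᵃ i c j d + countStartingWithᵇ i c j d
  count-runs i (suc c) j d       _ =
    trans (count-first (a (suc i)) (run a (suc i) c ++ run b j d)) (sumPicks-runs i (suc c) j d)
  count-runs i zero    j (suc d) _ =
    trans (count-first (b (suc j)) (run b (suc j) d)) (sumPicks-runs i zero j (suc d))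

  -- The weight of placing a_{x+1} (resp. b_{y+1}) once a₁, …, a_x and b₁, …, b_y are placed.
  gateA gateB : Weight
  gateA x y = 𝟙 (does (β (suc x) ≤? y))
  gateB x y = 𝟙 (does (α (suc y) ≤? x))

  precedes-a⇔ : ∀ {m n i c j d} → β m < n → i + suc c ≡ m → j + d ≡ n →
                Precedes (a (suc i)) (run a (suc i) c ++ run b j d) ⇔ β (suc i) ≤ j
  precedes-a⇔ {m} {n} {i} {c} {j} {d} β<n i+c≡m j+d≡n = mk⇔ (to d j+d≡n) from
    where
    to : ∀ d → j + d ≡ n → Precedes (a (suc i)) (run a (suc i) c ++ run b j d) → β (suc i) ≤ j
    to d j+d≡n prec with β (suc i) ≤? j
    to _       _     _    | yes β≤j = β≤j
    to zero    j+0≡n _    | no  _   =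
      <⇒≤ (≤-<-trans (β-mono i<m) (subst (β m <_) (trans (sym j+0≡n) (+-identityʳ j)) β<n))
      where
      i<m : suc i ≤ m
      i<m = ≤-trans (s≤s (m≤m+n i c)) (≤-reflexive (trans (sym (+-suc i c)) i+c≡m))
    to (suc d) _     prec | no  β≰j =
      ⊥-elim (All.lookup prec (∈-++⁺ʳ (run a (suc i) c) (here refl)) (≤β⇒b≼a (s≤s z≤n) (≰⇒> β≰j)))
    from : β (suc i) ≤ j → Precedes (a (suc i)) (run a (suc i) c ++ run b j d)
    from β≤j = ++⁺ (All.tabulate aboveA) (All.tabulate aboveB)
      where
      aboveA : ∀ {x} → x ∈ run a (suc i) c → ¬ x ≼ a (suc i)
      aboveA x∈ with ∈-run⁻ a (suc i) c x∈
      ... | k , i<k , refl = <⇒≱ i<k ∘ aIndex-mono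
      aboveB : ∀ {x} → x ∈ run b j d → ¬ x ≼ a (suc i)
      aboveB x∈ with ∈-run⁻ b j d x∈
      ... | l , j<l , refl = <⇒≱ (≤-<-trans β≤j j<l) ∘ bIndex-mono

  precedes-b⇔ : ∀ {m n i c j d} → α n < m → i + c ≡ m → j + suc d ≡ n →
                Precedes (b (suc j)) (run a i c ++ run b (suc j) d) ⇔ α (suc j) ≤ i
  precedes-b⇔ {m} {n} {i} {c} {j} {d} α<m i+c≡m j+d≡n = mk⇔ (to c i+c≡m) from
    where
    to : ∀ c → i + c ≡ m → Precedes (b (suc j)) (run a i c ++ run b (suc j) d) → α (suc j) ≤ i
    to c i+c≡m prec with α (suc j) ≤? i
    to _       _     _    | yes α≤i = α≤i
    to zero    i+0≡m _    | no  _   =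
      <⇒≤ (≤-<-trans (α-mono j<n) (subst (α n <_) (trans (sym i+0≡m) (+-identityʳ i)) α<m))
      where
      j<n : suc j ≤ n
      j<n = ≤-trans (s≤s (m≤m+n j d)) (≤-reflexive (trans (sym (+-suc j d)) j+d≡n))
    to (suc c) _     prec | no  α≰i = ⊥-elim (All.head prec (≤α⇒a≼b (s≤s z≤n) (≰⇒> α≰i)))
    from : α (suc j) ≤ i → Precedes (b (suc j)) (run a i c ++ run b (suc j) d)
    from α≤i = ++⁺ (All.tabulate aboveA) (All.tabulate aboveB)
      where
      aboveA : ∀ {x} → x ∈ run a i c → ¬ x ≼ b (suc j)
      aboveA x∈ with ∈-run⁻ a i c x∈
      ... | k , i<k , refl = <⇒≱ (≤-<-trans α≤i i<k) ∘ aIndex-mono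
      aboveB : ∀ {x} → x ∈ run b (suc j) d → ¬ x ≼ b (suc j)
      aboveB x∈ with ∈-run⁻ b (suc j) d x∈
      ... | l , j<l , refl = <⇒≱ j<l ∘ bIndex-mono

  Translated : Weight → Weight → ℕ → ℕ → Set
  Translated A G i j = ∀ x y → A x y ≡ G (i + x) (j + y)

  translated-origin : ∀ G i j {A} → Translated A G i j → A 0 0 ≡ G i j
  translated-origin G i j A≡G = trans (A≡G 0 0) (cong₂ G (+-identityʳ i) (+-identityʳ j))

  translated-↑ˣ : ∀ G i j {A} → Translated A G i j → Translated (A ↑ˣ) G (suc i) j
  translated-↑ˣ G i j A≡G x y = trans (A≡G (suc x) y) (cong (λ t → G t (j + y)) (+-suc i x))

  translated-↑ʸ : ∀ G i j {A} → Translated A G i j → Translated (A ↑ʸ) G i (suc j)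
  translated-↑ʸ G i j A≡G x y = trans (A≡G x (suc y)) (cong (G (i + x)) (+-suc j y))

  module _ {m n} (tops : TopsIncomparable m n) where

    private
      β<n : β m < n
      β<n = proj₁ tops

      α<m : α n < m
      α<m = proj₂ tops

      countStartingWithᵃ-step : ∀ {i c j d A X} → i + suc c ≡ m → j + d ≡ n → Translated A gateA i j →
               count (run a (suc i) c ++ run b j d) ≡ X → countStartingWithᵃ i (suc c) j d ≡ A 0 0 * X
      countStartingWithᵃ-step {i} {c} {j} {d} i+c≡m j+d≡n A≡ count≡X = cong₂ _*_
        (trans (cong 𝟙 (does-⇔ (precedes-a⇔ β<n i+c≡m j+d≡n) (precedes? _ _) (β (suc i) ≤? j))) (sym (translated-origin gateA i j A≡)))
        count≡X

      countStartingWithᵇ-step : ∀ {i c j d B X} → i + c ≡ m → j + suc d ≡ n → Translated B gateB i j →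
               count (run a i c ++ run b (suc j) d) ≡ X → countStartingWithᵇ i c j (suc d) ≡ B 0 0 * X
      countStartingWithᵇ-step {i} {c} {j} {d} i+c≡m j+d≡n B≡ count≡X = cong₂ _*_
        (trans (cong 𝟙 (does-⇔ (precedes-b⇔ α<m i+c≡m j+d≡n) (precedes? _ _) (α (suc j) ≤? i))) (sym (translated-origin gateB i j B≡)))
        count≡X

    count-runs≡pathsByFirstStep : ∀ c d {i j A B} → i + c ≡ m → j + d ≡ n → Translated A gateA i j → Translated B gateB i j →
                                  count (run a i c ++ run b j d) ≡ pathsByFirstStep A B c d
    count-runs≡pathsByFirstStep zero    zero    _ _ _ _ = refl
    count-runs≡pathsByFirstStep (suc c) zero    {i} {j} i+c≡m j+d≡n A≡ B≡ =
      trans (count-runs i (suc c) j 0 (s≤s z≤n)) (trans (+-identityʳ _)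
        (countStartingWithᵃ-step i+c≡m j+d≡n A≡ (count-runs≡pathsByFirstStep c 0 (trans (sym (+-suc i c)) i+c≡m) j+d≡n
                                  (translated-↑ˣ gateA i j A≡) (translated-↑ˣ gateB i j B≡))))
    count-runs≡pathsByFirstStep zero    (suc d) {i} {j} i+c≡m j+d≡n A≡ B≡ =
      trans (count-runs i 0 j (suc d) (s≤s z≤n))
        (countStartingWithᵇ-step i+c≡m j+d≡n B≡ (count-runs≡pathsByFirstStep 0 d i+c≡m (trans (sym (+-suc j d)) j+d≡n)
                                  (translated-↑ʸ gateA i j A≡) (translated-↑ʸ gateB i j B≡)))
    count-runs≡pathsByFirstStep (suc c) (suc d) {i} {j} i+c≡m j+d≡n A≡ B≡ =
      trans (count-runs i (suc c) j (suc d) (s≤s z≤n)) (cong₂ _+_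
        (countStartingWithᵃ-step i+c≡m j+d≡n A≡ (count-runs≡pathsByFirstStep c (suc d) (trans (sym (+-suc i c)) i+c≡m) j+d≡n
                                  (translated-↑ˣ gateA i j A≡) (translated-↑ˣ gateB i j B≡)))
        (countStartingWithᵇ-step i+c≡m j+d≡n B≡ (count-runs≡pathsByFirstStep (suc c) d i+c≡m (trans (sym (+-suc j d)) j+d≡n)
                                  (translated-↑ʸ gateA i j A≡) (translated-↑ʸ gateB i j B≡))))

    E≡paths : E m n ≡ paths gateA gateB m n
    E≡paths = begin
      E m n                            ≡⟨ cong count (elems≡runs m n) ⟩
      count (run a 0 m ++ run b 0 n)   ≡⟨ count-runs≡pathsByFirstStep m n refl refl (λ _ _ → refl) (λ _ _ → refl) ⟩
      pathsByFirstStep gateA gateB m n ≡⟨ pathsByFirstStep≡paths gateA gateB m n ⟩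
      paths gateA gateB m n            ∎
      where open ≡-Reasoning

  ≤-shift-⇔ : (h : ℕ → ℕ) → h 1 ≡ 0 → h 6 ≤ 5 → (∀ k → h (suc (suc k) + 5) ≡ h (suc (suc k)) + 5) →
              ∀ x y → (h (suc x + 5) ≤ y + 5) ⇔ (h (suc x) ≤ y)
  ≤-shift-⇔ h h1≡0 h6≤5 periodic zero    y = mk⇔ (λ _ → subst (_≤ y) (sym h1≡0) z≤n) (λ _ → ≤-trans h6≤5 (m≤n+m 5 y))
  ≤-shift-⇔ h h1≡0 h6≤5 periodic (suc x) y = mk⇔
    (λ le → +-cancelʳ-≤ 5 _ _ (subst (_≤ y + 5) (periodic x) le))
    (λ le → subst (_≤ y + 5) (sym (periodic x)) (+-monoˡ-≤ 5 le))

  gateA-invariant : DiagonallyInvariant 5 gateA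
  gateA-invariant x y =
    cong 𝟙 (does-⇔ (≤-shift-⇔ β refl (n≤1+n 4) β-periodic x y) (β (suc (x + 5)) ≤? y + 5) (β (suc x) ≤? y))

  gateB-invariant : DiagonallyInvariant 5 gateB
  gateB-invariant x y =
    cong 𝟙 (does-⇔ (≤-shift-⇔ α refl (n≤1+n 4) α-periodic y x) (α (suc (y + 5)) ≤? x + 5) (α (suc y) ≤? x))

  gateA-closed : ∀ x y → y < β (suc x) → gateA x y ≡ 0
  gateA-closed x y y<β = cong 𝟙 (dec-false (β (suc x) ≤? y) (<⇒≱ y<β))

  gateB-closed : ∀ x y → x < α (suc y) → gateB x y ≡ 0
  gateB-closed x y x<α = cong 𝟙 (dec-false (α (suc y) ≤? x) (<⇒≱ x<α))

  paths-vanishes-below-α : ∀ i j → i < α j → paths gateA gateB i j ≡ 0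
  paths-vanishes-below-α i       zero    ()
  paths-vanishes-below-α zero    (suc j) i<α = cong (_* paths gateA gateB 0 j) (gateB-closed 0 j i<α)
  paths-vanishes-below-α (suc i) (suc j) i<α = cong₂ _+_
    (trans (cong (gateA i (suc j) *_) (paths-vanishes-below-α i (suc j) (≤-trans (n≤1+n _) i<α)))
           (*-zeroʳ (gateA i (suc j))))
    (cong (_* paths gateA gateB (suc i) j) (gateB-closed (suc i) j i<α))

  paths-vanishes-below-β : ∀ i j → j < β i → paths gateA gateB i j ≡ 0
  paths-vanishes-below-β zero    j       ()
  paths-vanishes-below-β (suc i) zero    j<β = cong (_* paths gateA gateB i 0) (gateA-closed i 0 j<β)
  paths-vanishes-below-β (suc i) (suc j) j<β = cong₂ _+_
    (cong (_* paths gateA gateB i (suc j)) (gateA-closed i (suc j) j<β))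
    (trans (cong (gateB (suc i) j *_) (paths-vanishes-below-β (suc i) j (≤-trans (n≤1+n _) j<β)))
           (*-zeroʳ (gateB (suc i) j)))

  open ShiftRecurrence gateA gateB 5 10 27 164
    gateA-invariant (diagonallyInvariant-+ gateA-invariant gateA-invariant)
    gateB-invariant (diagonallyInvariant-+ gateB-invariant gateB-invariant)

  -- Away from the origin, all three path counts on a boundary line vanish.
  column : ∀ j → ShiftRelation 0 (suc j)
  column zero    = refl
  column (suc j) = trans
    (cong₂ (λ u v → u + 27 * v)
           (paths-vanishes-below-α 10 (2 + j + 10) (α-mono (+-monoʳ-≤ 2 (m≤n+m 10 j))))
           (paths-vanishes-below-α 0 (2 + j) (1≤α j)))
    (sym (cong (164 *_) (paths-vanishes-below-α 5 (2 + j + 5) (α-mono (+-monoʳ-≤ 2 (m≤n+m 5 j))))))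

  row : ∀ i → ShiftRelation (suc i) 0
  row 0 = refl
  row 1 = refl
  row 2 = refl
  row (suc (suc (suc i))) = trans
    (cong₂ (λ u v → u + 27 * v)
           (paths-vanishes-below-β (4 + i + 10) 10 (≤-trans (n≤1+n 11) (β-mono (+-monoʳ-≤ 4 (m≤n+m 10 i)))))
           (paths-vanishes-below-β (4 + i) 0 (1≤β i)))
    (sym (cong (164 *_) (paths-vanishes-below-β (4 + i + 5) 5 (≤-trans (n≤1+n 6) (β-mono (+-monoʳ-≤ 4 (m≤n+m 5 i)))))))

  E-recurrence : ∀ {m n} → 1 ≤ m → 1 ≤ n → TopsIncomparable m n →
                 E (m + 10) (n + 10) + 27 * E m n ≡ 164 * E (m + 5) (n + 5)
  E-recurrence {suc m} {suc n} _ _ tops = begin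
    E (suc m + 10) (suc n + 10) + 27 * E (suc m) (suc n)
      ≡⟨ cong₂ (λ u v → u + 27 * v) (E≡paths (tops-+10 tops)) (E≡paths tops) ⟩
    paths gateA gateB (suc m + 10) (suc n + 10) + 27 * paths gateA gateB (suc m) (suc n)
      ≡⟨ shiftRelation-from-boundary column row m n ⟩
    164 * paths gateA gateB (suc m + 5) (suc n + 5)
      ≡⟨ cong (164 *_) (sym (E≡paths (tops-+5 tops))) ⟩
    164 * E (suc m + 5) (suc n + 5) ∎
    where open ≡-Reasoning

open import Data.Nat using (ℕ; _≤_; _+_)
open import Data.Integer using (+_; _*_; _-_)
open import Relation.Binary.PropositionalEquality using (_≡_)
open import Defs using (E; Admissible)
open NaturalToInteger using (ℕ-relation⇒ℤ)
open TwoChainPoset using (admissible⇒tops)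
open ExtensionCounts using (E-recurrence)

mainTheorem3 : (m n : ℕ) → 1 ≤ m → 1 ≤ n → Admissible m n →
    + E (m + 10) (n + 10) ≡ + 164 * + E (m + 5) (n + 5) - + 27 * + E m n
mainTheorem3 m n 1≤m 1≤n adm =
  ℕ-relation⇒ℤ (E (m + 10) (n + 10)) (E (m + 5) (n + 5)) (E m n) 27 164
    (E-recurrence 1≤m 1≤n (admissible⇒tops 1≤m 1≤n adm))
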